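{- Let $n\geq 4$ and let $H_n$ be the graph with vertex set $\{v_{i,j} : i\in\{0,\dots,n-1\},\ j\in\mathbb Z_3\}$ in which $v_{i,j}v_{i,j'}$ is an edge for all $i$ and $j\neq j'$, $v_{i,j}v_{i+1,j}$ is an edge for $0\leq i\leq n-2$, and $v_{0,j}v_{n-1,-j}$ is an edge for all $j\in\mathbb Z_3$ (no other edges). Let $W\subseteq V(H_n)$ satisfy the standing assumptions described in the context. If the sign sequence $\sigma^W$ is good, then the graph $H_n^{(W)}$ is $4$-colourable.
   Context: Let $C_i=\{v_{i,j}:j\in\mathbb Z_3\}$ and $R_j=\{v_{i,j}:0\le i\le n-1\}$. Standing assumptions on $W$: none of the following holds: (a) $|W\cap C_i|\ge 2$ for some $i$; (b) $W$ contains at least $n-1$ vertices of $R_0$ and $n$ is odd; (c) the subgraph of $H_n$ induced on $W\setminus R_0$ contains a path with at least $n$ vertices and $n$ is even; and moreover $|W\cap C_i|=1$ for every $i$. Write $W\cap C_i=\{v_{i,w_i}\}$ with $w_i\in\mathbb Z_3$. $H_n^{(W)}$ is obtained by replicating each $w\in W$: adding a new vertex $w'$ adjacent to $w$ and all its neighbours. A sign sequence is a finite sequence of elements of $\mathbb Z_3$; we write $+$ for $1$ and $-$ for $2=-1$. The sign sequence of $W$ is $\sigma^W=s_0\dots s_{n-1}$ with $s_i=w_{i+1}-w_i$ for $0\le i\le n-2$ and $s_{n-1}=-w_0-w_{n-1}$. A pattern is a cyclically ordered partition of $\{1,2,3,4\}$ into three parts, one of size 2 and two of size 1; patterns differing by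 a cyclic shift of parts are identical. Write $(xy|z|w)$ for the pattern $(\{x,y\},\{z\},\{w\})$. For a pattern $\pi=(xy|z|w)$: the patterns $+$-compatible with $\pi$ are $\pi$ itself and the two patterns obtained by moving one of $x,y$ into the part preceding $\{x,y\}$ in the cyclic order (i.e. into $\{w\}$); the patterns $-$-compatible with $\pi$ are $\pi$ and the two obtained by moving one of $x,y$ into the following part $\{z\}$; the patterns $0$-compatible with $\pi$ are $(zw|x|y)$ and $(zw|y|x)$. Let $D$ be the graph on the 12 patterns with an undirected edge $\pi\rho$ when $\rho$ is $0$-compatible with $\pi$ (a symmetric relation), and a directed edge (possibly a loop) from $\pi$ to $\rho$ when $\rho$ is $+$-compatible with $\pi$. For a sign sequence $\sigma=s_0\dots s_k$, a $\sigma$-stroll is a sequence $\pi_0\pi_1\dots\pi_{k+1}$ of patterns such that for each $0\le j\le k$: if $s_j=0$ then $\pi_j\pi_{j+1}$ is an undirected edge of $D$; if $s_j=1$ there is a directed edge (possibly a loop) from $\pi_j$ to $\pi_{j+1}$; if $s_j=-1$ there is a directed edge (possibly a loop) from $\pi_{j+1}$ to $\pi_j$. It goes from $\pi_0$ to $\pi_{k+1}$. The sequence $\sigma$ is good if there is a $\sigma$-stroll from $(12|3|4)$ to $(12|4|3)$. -}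

module Defs where

open import Data.Nat using (ℕ; zero; suc; _+_; _∸_; _≤_; _%_)
open import Data.Fin using (Fin; zero; suc; toℕ; fromℕ; inject₁)
open import Data.Bool using (Bool; true; false; if_then_else_)
open import Data.List using (List; []; _∷_; _++_)
open import Data.Product using (Σ; ∃; _×_; _,_)
open import Data.Sum using (_⊎_)
open import Function.Definitions using (Injective)
open import Relation.Binary.PropositionalEquality using (_≡_; _≢_)

-- ℤ₃ represented by Fin 3 (0 ↦ 0, 1 ↦ 1 = "+", 2 ↦ 2 = -1 = "-")

Z3 : Set
Z3 = Fin 3

_+₃_ : Z3 → Z3 → Z3
zero +₃ b = b
suc zero +₃ zero = suc zero
suc zero +₃ suc zero = suc (suc zero)
suc zero +₃ suc (suc zero) = zero
suc (suc zero) +₃ zero = suc (suc zero)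
suc (suc zero) +₃ suc zero = zero
suc (suc zero) +₃ suc (suc zero) = suc zero

-₃_ : Z3 → Z3
-₃ zero = zero
-₃ suc zero = suc (suc zero)
-₃ suc (suc zero) = suc zero

_-₃_ : Z3 → Z3 → Z3
a -₃ b = a +₃ (-₃ b)

V : ℕ → Set
V n = Fin n × Z3

HAdj : (n : ℕ) → V n → V n → Set
HAdj n (i , j) (i' , j') =
    (i ≡ i' × j ≢ j')
  ⊎ (j ≡ j' × suc (toℕ i) ≡ toℕ i')
  ⊎ (j ≡ j' × suc (toℕ i') ≡ toℕ i)
  ⊎ (toℕ i ≡ 0 × suc (toℕ i') ≡ n × j' ≡ -₃ j)
  ⊎ (toℕ i' ≡ 0 × suc (toℕ i) ≡ n × j ≡ -₃ j')

-- Vertices: the original vertices, plus a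
-- copy w' for every w ∈ W.  w' is adjacent to w and all neighbours of w;
-- copies w', x' are adjacent iff w x is an edge (the result of
-- replicating the vertices of W one after another; independent of order).

RV : (n : ℕ) → (V n → Bool) → Set
RV n W = V n ⊎ Σ (V n) (λ v → W v ≡ true)

RAdj : (n : ℕ) (W : V n → Bool) → RV n W → RV n W → Set
RAdj n W (Data.Sum.inj₁ u) (Data.Sum.inj₁ v) = HAdj n u v
RAdj n W (Data.Sum.inj₁ u) (Data.Sum.inj₂ (v , _)) = u ≡ v ⊎ HAdj n v u
RAdj n W (Data.Sum.inj₂ (u , _)) (Data.Sum.inj₁ v) = u ≡ v ⊎ HAdj n u v
RAdj n W (Data.Sum.inj₂ (u , _)) (Data.Sum.inj₂ (v , _)) = HAdj n u v

Colourable : (k : ℕ) (X : Set) → (X → X → Set) → Set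
Colourable k X E = Σ (X → Fin k) (λ c → ∀ a b → E a b → c a ≢ c b)

count : {n : ℕ} → (Fin n → Bool) → ℕ
count {zero} f = 0
count {suc n} f = (if f zero then 1 else 0) + count (λ i → f (suc i))

CondA : (n : ℕ) → (V n → Bool) → Set
CondA n W = Σ (Fin n) λ i → Σ Z3 λ j → Σ Z3 λ j' →
  j ≢ j' × W (i , j) ≡ true × W (i , j') ≡ true

CondB : (n : ℕ) → (V n → Bool) → Set
CondB n W = (n ∸ 1 ≤ count (λ i → W (i , zero))) × n % 2 ≡ 1

InducedPathWithoutR0 : (n : ℕ) → (V n → Bool) → Set
InducedPathWithoutR0 n W = Σ ℕ λ m → Σ (Fin (suc m) → V n) λ f →
    n ≤ suc m
  × Injective _≡_ _≡_ f
  × (∀ t → W (f t) ≡ true)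
  × (∀ t → Data.Product.proj₂ (f t) ≢ zero)
  × (∀ (t : Fin m) → HAdj n (f (inject₁ t)) (f (suc t)))

CondC : (n : ℕ) → (V n → Bool) → Set
CondC n W = InducedPathWithoutR0 n W × n % 2 ≡ 0

-- Sign sequence σ^W = s_0 … s_{n-1}, s_i = w_{i+1} - w_i (i ≤ n-2),
-- s_{n-1} = - w_0 - w_{n-1}.

diffs : {m : ℕ} → (Fin (suc m) → Z3) → List Z3
diffs {zero} w = []
diffs {suc m} w = (w (suc zero) -₃ w zero) ∷ diffs (λ i → w (suc i))

signSeq : {n : ℕ} → (Fin n → Z3) → List Z3
signSeq {zero} w = []
signSeq {suc m} w = diffs w ++ (((-₃ w zero) -₃ w (fromℕ m)) ∷ [])

-- Elements 1,2,3,4 are represented by Fin 4 (k ↦ k+1).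
-- A pattern (xy|z|w) is uniquely determined by the ordered pair (z , w)
-- of its singleton parts: z is the part following {x,y} in the cyclic
-- order, w the part preceding it, and {x,y} = {1,2,3,4} \ {z,w}.
-- So the 12 patterns correspond to ordered pairs (z , w) with z ≠ w.

record Pattern : Set where
  constructor pat
  field
    after  : Fin 4
    before : Fin 4
    distinct : after ≢ before
open Pattern public

InPair : Fin 4 → Pattern → Set
InPair a π = (a ≢ after π) × (a ≢ before π)

SamePattern : Pattern → Pattern → Set
SamePattern π ρ = (after π ≡ after ρ) × (before π ≡ before ρ)

-- ρ is +-compatible with π = (xy|z|w): ρ = π, or ρ = (wx|y|z) / (wy|x|z),
-- i.e. ρ = (a' | a | z) for a ∈ {x,y}.
PlusCompat : Pattern → Pattern → Set
PlusCompat π ρ = SamePattern π ρ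
  ⊎ (InPair (after ρ) π × before ρ ≡ after π)

-- ρ is 0-compatible with π = (xy|z|w): ρ = (zw|x|y) or (zw|y|x).
ZeroCompat : Pattern → Pattern → Set
ZeroCompat π ρ = InPair (after ρ) π × InPair (before ρ) π

Step : Z3 → Pattern → Pattern → Set
Step zero π ρ = ZeroCompat π ρ
Step (suc zero) π ρ = PlusCompat π ρ
Step (suc (suc zero)) π ρ = PlusCompat ρ π

data Stroll : List Z3 → Pattern → Pattern → Set where
  done : ∀ {π ρ} → SamePattern π ρ → Stroll [] π ρ
  step : ∀ {s σ π ρ τ} → Step s π ρ → Stroll σ ρ τ → Stroll (s ∷ σ) π τ

p12|3|4 : Pattern
p12|3|4 = pat (suc (suc zero)) (suc (suc (suc zero))) (λ ())

p12|4|3 : Pattern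
p12|4|3 = pat (suc (suc (suc zero))) (suc (suc zero)) (λ ())

Good : List Z3 → Set
Good σ = Stroll σ p12|3|4 p12|4|3

-- Label column C_i by the i-th pattern π_i of a σ^W-stroll.  The parts of (xy|z|w), in the
-- cyclic order {x,y}, {z}, {w}, are the colours allowed at offsets 0, 1, 2, where v_{i,j} has
-- offset j - w_i; the replica of v_{i,w_i} takes the other colour of {x,y}, so each column with
-- its replica is rainbow.  Along an edge v_{i,j}v_{i+1,j} the offset drops by s_i, and
-- s_i-compatibility of π_{i+1} with π_i says precisely that the parts met at the two ends are
-- disjoint.  The twisted edges v_{0,j}v_{n-1,-j} are handled by the last step, since its target
-- (12|4|3) is (12|3|4) = π_0 with offsets negated.
module Submission where

open import Defs
open import Data.Nat using (ℕ; zero; suc; _≤_; s≤s)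
open import Data.Nat.Properties using (suc-injective)
open import Data.Fin using (Fin; zero; suc; toℕ; fromℕ; punchIn; punchOut)
open import Data.Fin.Properties
  using (_≟_; all?; toℕ-injective; toℕ-fromℕ; punchIn-injective; punchInᵢ≢i; punchIn-punchOut; punchOut-injective)
open import Data.Bool using (Bool; true)
open import Data.List using (List; []; _∷_; _++_)
open import Data.Product using (Σ; _,_; _×_; proj₁; proj₂)
open import Data.Sum using (inj₁; inj₂)
open import Data.Empty using (⊥; ⊥-elim)
open import Function using (_∘_)
open import Relation.Nullary using (¬_)
open import Relation.Nullary.Decidable using (from-yes; _→-dec_)
open import Relation.Binary.PropositionalEquality using (_≡_; _≢_; refl; sym; trans; cong; subst)

-₃-cancelʳ : ∀ a j j' → j -₃ a ≡ j' -₃ a → j ≡ j'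
-₃-cancelʳ = from-yes (all? λ a → all? λ j → all? λ j' → (j -₃ a ≟ j' -₃ a) →-dec (j ≟ j'))

-₃-self : ∀ a → a -₃ a ≡ zero
-₃-self = from-yes (all? λ a → a -₃ a ≟ zero)

-₃-shift : ∀ a b j → (j -₃ a) -₃ (b -₃ a) ≡ j -₃ b
-₃-shift = from-yes (all? λ a → all? λ b → all? λ j → (j -₃ a) -₃ (b -₃ a) ≟ j -₃ b)

-₃-antipodal-shift : ∀ a b j → ((-₃ j) -₃ b) -₃ ((-₃ a) -₃ b) ≡ -₃ (j -₃ a)
-₃-antipodal-shift =
  from-yes (all? λ a → all? λ b → all? λ j → ((-₃ j) -₃ b) -₃ ((-₃ a) -₃ b) ≟ -₃ (j -₃ a))

Fin2-no-three-distinct : (i j k : Fin 2) → i ≢ j → i ≢ k → j ≢ k → ⊥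
Fin2-no-three-distinct zero       zero       _          i≢j _   _   = i≢j refl
Fin2-no-three-distinct (suc zero) (suc zero) _          i≢j _   _   = i≢j refl
Fin2-no-three-distinct zero       (suc zero) zero       _   i≢k _   = i≢k refl
Fin2-no-three-distinct zero       (suc zero) (suc zero) _   _   j≢k = j≢k refl
Fin2-no-three-distinct (suc zero) zero       zero       _   _   j≢k = j≢k refl
Fin2-no-three-distinct (suc zero) zero       (suc zero) _   i≢k _   = i≢k refl

module _ {n : ℕ} {a b : Fin (suc (suc n))} (a≢b : a ≢ b) where

  punchIn₂ : Fin n → Fin (suc (suc n))
  punchIn₂ k = punchIn a (punchIn (punchOut a≢b) k)

  punchIn₂≢ˡ : ∀ k → punchIn₂ k ≢ a
  punchIn₂≢ˡ k = punchInᵢ≢i a _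

  punchIn₂≢ʳ : ∀ k → punchIn₂ k ≢ b
  punchIn₂≢ʳ k e = punchInᵢ≢i (punchOut a≢b) k
    (punchIn-injective a _ _ (trans e (sym (punchIn-punchOut a≢b))))

  punchIn₂-injective : ∀ k l → punchIn₂ k ≡ punchIn₂ l → k ≡ l
  punchIn₂-injective k l = punchIn-injective (punchOut a≢b) k l ∘ punchIn-injective a _ _

  private
    punchOut-separates : ∀ {c} (c≢a : c ≢ a) → c ≢ b → punchOut a≢b ≢ punchOut (c≢a ∘ sym)
    punchOut-separates c≢a c≢b = c≢b ∘ sym ∘ punchOut-injective a≢b (c≢a ∘ sym)

  punchOut₂ : {c : Fin (suc (suc n))} → c ≢ a → c ≢ b → Fin n
  punchOut₂ c≢a c≢b = punchOut (punchOut-separates c≢a c≢b)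

  punchOut₂-injective : ∀ {c d} (c≢a : c ≢ a) (c≢b : c ≢ b) (d≢a : d ≢ a) (d≢b : d ≢ b)
    → punchOut₂ c≢a c≢b ≡ punchOut₂ d≢a d≢b → c ≡ d
  punchOut₂-injective c≢a c≢b d≢a d≢b =
    punchOut-injective (c≢a ∘ sym) (d≢a ∘ sym)
    ∘ punchOut-injective (punchOut-separates c≢a c≢b) (punchOut-separates d≢a d≢b)

InPart : Pattern → Z3 → Fin 4 → Set
InPart π zero             c = InPair c π
InPart π (suc zero)       c = c ≡ after π
InPart π (suc (suc zero)) c = c ≡ before π

InPart-unique : ∀ π d d' {c} → InPart π d c → InPart π d' c → d ≡ d'
InPart-unique π zero             zero             _          _          = refl
InPart-unique π zero             (suc zero)       (c≢a , _)  c≡a        = ⊥-elim (c≢a c≡a)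
InPart-unique π zero             (suc (suc zero)) (_ , c≢b)  c≡b        = ⊥-elim (c≢b c≡b)
InPart-unique π (suc zero)       zero             c≡a        (c≢a , _)  = ⊥-elim (c≢a c≡a)
InPart-unique π (suc zero)       (suc zero)       _          _          = refl
InPart-unique π (suc zero)       (suc (suc zero)) c≡a        c≡b        =
  ⊥-elim (distinct π (trans (sym c≡a) c≡b))
InPart-unique π (suc (suc zero)) zero             c≡b        (_ , c≢b)  = ⊥-elim (c≢b c≡b)
InPart-unique π (suc (suc zero)) (suc zero)       c≡b        c≡a        =
  ⊥-elim (distinct π (trans (sym c≡a) c≡b))
InPart-unique π (suc (suc zero)) (suc (suc zero)) _          _          = refl

InPair-at-most-two : ∀ π {x y z} → InPair x π → InPair y π → InPair z π
  → x ≢ y → x ≢ z → y ≢ z → ⊥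
InPair-at-most-two π (x≢a , x≢b) (y≢a , y≢b) (z≢a , z≢b) x≢y x≢z y≢z =
  Fin2-no-three-distinct (out x≢a x≢b) (out y≢a y≢b) (out z≢a z≢b)
    (x≢y ∘ punchOut₂-injective (distinct π) x≢a x≢b y≢a y≢b)
    (x≢z ∘ punchOut₂-injective (distinct π) x≢a x≢b z≢a z≢b)
    (y≢z ∘ punchOut₂-injective (distinct π) y≢a y≢b z≢a z≢b)
  where
  out : ∀ {c} → c ≢ after π → c ≢ before π → Fin 2
  out = punchOut₂ (distinct π)

zero-separates : ∀ {π ρ c} d → ZeroCompat π ρ → InPart π d c → InPart ρ (d -₃ zero) c → ⊥
zero-separates {π} {ρ} zero (a'∈π , b'∈π) c∈π (c≢a' , c≢b') =
  InPair-at-most-two π c∈π a'∈π b'∈π c≢a' c≢b' (distinct ρ)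
zero-separates (suc zero)       ((a'≢a , _) , _) c≡a c≡a' = a'≢a (trans (sym c≡a') c≡a)
zero-separates (suc (suc zero)) (_ , (_ , b'≢b)) c≡b c≡b' = b'≢b (trans (sym c≡b') c≡b)

plus-separates : ∀ {π ρ c} d → PlusCompat π ρ → InPart π d c → InPart ρ (d -₃ suc zero) c → ⊥
plus-separates zero             (inj₁ (_ , b≡b'))   (_ , c≢b) c≡b'      = c≢b (trans c≡b' (sym b≡b'))
plus-separates (suc zero)       (inj₁ (a≡a' , _))   c≡a       (c≢a' , _) = c≢a' (trans c≡a a≡a')
plus-separates {π} (suc (suc zero)) (inj₁ (a≡a' , _)) c≡b   c≡a'      =
  distinct π (trans a≡a' (trans (sym c≡a') c≡b))
plus-separates zero             (inj₂ (_ , b'≡a))   (c≢a , _) c≡b'      = c≢a (trans c≡b' b'≡a)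
plus-separates (suc zero)       (inj₂ (_ , b'≡a))   c≡a       (_ , c≢b') = c≢b' (trans c≡a (sym b'≡a))
plus-separates (suc (suc zero)) (inj₂ ((_ , a'≢b) , _)) c≡b c≡a'        = a'≢b (trans (sym c≡a') c≡b)

step-separates : ∀ {π ρ c} s d → Step s π ρ → InPart π d c → InPart ρ (d -₃ s) c → ⊥
step-separates zero       d = zero-separates d
step-separates (suc zero) d = plus-separates d
step-separates {π} {ρ} (suc (suc zero)) zero             ρ→π c∈π c∈ρ =
  plus-separates {ρ} {π} (suc zero) ρ→π c∈ρ c∈π
step-separates {π} {ρ} (suc (suc zero)) (suc zero)       ρ→π c∈π c∈ρ =
  plus-separates {ρ} {π} (suc (suc zero)) ρ→π c∈ρ c∈π
step-separates {π} {ρ} (suc (suc zero)) (suc (suc zero)) ρ→π c∈π c∈ρ =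
  plus-separates {ρ} {π} zero ρ→π c∈ρ c∈π

Reversed : Pattern → Pattern → Set
Reversed π ρ = after ρ ≡ before π × before ρ ≡ after π

InPart-reversed : ∀ {π ρ c} d → Reversed π ρ → InPart π d c → InPart ρ (-₃ d) c
InPart-reversed zero             (a'≡b , b'≡a) (c≢a , c≢b) =
  (λ c≡a' → c≢b (trans c≡a' a'≡b)) , (λ c≡b' → c≢a (trans c≡b' b'≡a))
InPart-reversed (suc zero)       (_ , b'≡a) c≡a = trans c≡a (sym b'≡a)
InPart-reversed (suc (suc zero)) (a'≡b , _) c≡b = trans c≡b (sym a'≡b)

pairColour : Pattern → Fin 2 → Fin 4
pairColour π = punchIn₂ (distinct π)

partColour : Pattern → Z3 → Fin 4
partColour π zero             = pairColour π zero
partColour π (suc zero)       = after π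
partColour π (suc (suc zero)) = before π

spareColour : Pattern → Fin 4
spareColour π = pairColour π (suc zero)

pairColour-InPair : ∀ π k → InPair (pairColour π k) π
pairColour-InPair π k = punchIn₂≢ˡ (distinct π) k , punchIn₂≢ʳ (distinct π) k

partColour-InPart : ∀ π d → InPart π d (partColour π d)
partColour-InPart π zero             = pairColour-InPair π zero
partColour-InPart π (suc zero)       = refl
partColour-InPart π (suc (suc zero)) = refl

spareColour≢partColour : ∀ π → spareColour π ≢ partColour π zero
spareColour≢partColour π e with punchIn₂-injective (distinct π) (suc zero) zero e
... | ()

record Labelling {m : ℕ} (w : Fin (suc m) → Z3) (π : Pattern) (σ : List Z3) (τ : Pattern) : Set where
  field
    label      : Fin (suc m) → Pattern
    label-zero : label zero ≡ π
    label-step : ∀ i i' → suc (toℕ i) ≡ toℕ i' → Step (w i' -₃ w i) (label i) (label i')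
    label-rest : Stroll σ (label (fromℕ m)) τ

stroll⇒labelling : ∀ {m} (w : Fin (suc m) → Z3) {π σ τ} → Stroll (diffs w ++ σ) π τ → Labelling w π σ τ
stroll⇒labelling {zero} w {π} stroll = record
  { label = λ _ → π ; label-zero = refl ; label-step = λ { zero zero () } ; label-rest = stroll }
stroll⇒labelling {suc m} w {π} (step π→ρ stroll) = record
  { label = label ; label-zero = refl ; label-step = label-step ; label-rest = L.label-rest }
  where
  module L = Labelling (stroll⇒labelling (w ∘ suc) stroll)

  label : Fin (suc (suc m)) → Pattern
  label zero    = π
  label (suc i) = L.label i

  label-step : ∀ i i' → suc (toℕ i) ≡ toℕ i' → Step (w i' -₃ w i) (label i) (label i')
  label-step zero    (suc zero) _ = subst (Step _ π) (sym L.label-zero) π→ρ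
  label-step (suc i) (suc i')   e = L.label-step i i' (suc-injective e)
  label-step zero    zero       ()
  label-step zero    (suc (suc _)) ()
  label-step (suc _) zero       ()

single-step : ∀ {s π τ} → Stroll (s ∷ []) π τ → Σ Pattern λ ρ → Step s π ρ × SamePattern ρ τ
single-step (step π→ρ (done ρ≈τ)) = _ , π→ρ , ρ≈τ

module ReplicatedColouring
  {m : ℕ} (W : V (suc m) → Bool) (w : Fin (suc m) → Z3)
  (W⊆w : ∀ i j → W (i , j) ≡ true → j ≡ w i)
  (label : Fin (suc m) → Pattern)
  (label-step : ∀ i i' → suc (toℕ i) ≡ toℕ i' → Step (w i' -₃ w i) (label i) (label i'))
  {ρ : Pattern} (wrap-step : Step ((-₃ w zero) -₃ w (fromℕ m)) (label (fromℕ m)) ρ)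
  (wrap-reversed : Reversed (label zero) ρ)
  where

  Admissible : V (suc m) → Fin 4 → Set
  Admissible (i , j) = InPart (label i) (j -₃ w i)

  consecutive-separated : ∀ {i i' j c} → suc (toℕ i) ≡ toℕ i'
    → Admissible (i , j) c → Admissible (i' , j) c → ⊥
  consecutive-separated {i} {i'} {j} {c} i→i' c∈ c∈' =
    step-separates (w i' -₃ w i) (j -₃ w i) (label-step i i' i→i') c∈
      (subst (λ d → InPart (label i') d c) (sym (-₃-shift (w i) (w i') j)) c∈')

  antipodal-separated : ∀ {i i' j c} → toℕ i ≡ 0 → suc (toℕ i') ≡ suc m
    → Admissible (i , j) c → Admissible (i' , -₃ j) c → ⊥
  antipodal-separated {i} {i'} {j} {c} first last c∈ c∈'
    with toℕ-injective {i = i} {j = zero} first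
       | toℕ-injective {i = i'} {j = fromℕ m} (trans (suc-injective last) (sym (toℕ-fromℕ m)))
  ... | refl | refl =
    step-separates _ _ wrap-step c∈'
      (subst (λ d → InPart ρ d c) (sym (-₃-antipodal-shift (w zero) (w (fromℕ m)) j))
        (InPart-reversed _ wrap-reversed c∈))

  adjacent-separated : ∀ {u v c} → HAdj (suc m) u v → Admissible u c → Admissible v c → ⊥
  adjacent-separated {i , j} {_ , j'} (inj₁ (refl , j≢j')) c∈ c∈' =
    j≢j' (-₃-cancelʳ (w i) j j' (InPart-unique (label i) _ _ c∈ c∈'))
  adjacent-separated (inj₂ (inj₁ (refl , i→i'))) c∈ c∈' = consecutive-separated i→i' c∈ c∈'
  adjacent-separated (inj₂ (inj₂ (inj₁ (refl , i'→i)))) c∈ c∈' = consecutive-separated i'→i c∈' c∈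
  adjacent-separated (inj₂ (inj₂ (inj₂ (inj₁ (first , last , refl))))) c∈ c∈' =
    antipodal-separated first last c∈ c∈'
  adjacent-separated (inj₂ (inj₂ (inj₂ (inj₂ (first , last , refl))))) c∈ c∈' =
    antipodal-separated first last c∈' c∈

  base : RV (suc m) W → V (suc m)
  base (inj₁ u)       = u
  base (inj₂ (u , _)) = u

  colour : RV (suc m) W → Fin 4
  colour (inj₁ (i , j))       = partColour (label i) (j -₃ w i)
  colour (inj₂ ((i , _) , _)) = spareColour (label i)

  copy-offset : ∀ {i j} → W (i , j) ≡ true → j -₃ w i ≡ zero
  copy-offset {i} {j} j∈W = trans (cong (_-₃ w i) (W⊆w i j j∈W)) (-₃-self (w i))

  colour-admissible : ∀ x → Admissible (base x) (colour x)
  colour-admissible (inj₁ (i , j))          = partColour-InPart (label i) (j -₃ w i)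
  colour-admissible (inj₂ ((i , j) , j∈W)) =
    subst (λ d → InPart (label i) d (spareColour (label i))) (sym (copy-offset j∈W))
      (pairColour-InPair (label i) (suc zero))

  copy≢original : ∀ {i j} (j∈W : W (i , j) ≡ true) → colour (inj₂ ((i , j) , j∈W)) ≢ colour (inj₁ (i , j))
  copy≢original {i} j∈W e =
    spareColour≢partColour (label i) (trans e (cong (partColour (label i)) (copy-offset j∈W)))

  separated : ∀ x y → HAdj (suc m) (base x) (base y) → colour x ≢ colour y
  separated x y u~v cx≡cy =
    adjacent-separated u~v (colour-admissible x)
      (subst (Admissible (base y)) (sym cx≡cy) (colour-admissible y))

  colour-proper : ∀ x y → RAdj (suc m) W x y → colour x ≢ colour y
  colour-proper x@(inj₁ _)        y@(inj₁ _)        u~v         = separated x y u~v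
  colour-proper (inj₁ _)          (inj₂ (_ , v∈W))  (inj₁ refl) = copy≢original v∈W ∘ sym
  colour-proper x@(inj₁ _)        y@(inj₂ _)        (inj₂ v~u)  = separated y x v~u ∘ sym
  colour-proper (inj₂ (_ , u∈W))  (inj₁ _)          (inj₁ refl) = copy≢original u∈W
  colour-proper x@(inj₂ _)        y@(inj₁ _)        (inj₂ u~v)  = separated x y u~v
  colour-proper x@(inj₂ _)        y@(inj₂ _)        u~v         = separated x y u~v

lemma2p4 : (n : ℕ) → 4 ≤ n → (W : V n → Bool) → (w : Fin n → Z3)
    → (∀ i j → W (i , j) ≡ true → j ≡ w i)
    → (∀ i → W (i , w i) ≡ true)
    → ¬ CondA n W → ¬ CondB n W → ¬ CondC n W
    → Good (signSeq w)
    → Colourable 4 (RV n W) (RAdj n W)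
lemma2p4 (suc m) (s≤s _) W w W⊆w _ _ _ _ good = colour , colour-proper
  where
  open Labelling (stroll⇒labelling w good)

  wrap : Σ Pattern λ ρ → Step ((-₃ w zero) -₃ w (fromℕ m)) (label (fromℕ m)) ρ × SamePattern ρ p12|4|3
  wrap = single-step label-rest

  wrap-reversed : Reversed (label zero) (proj₁ wrap)
  wrap-reversed = subst (λ π → Reversed π (proj₁ wrap)) (sym label-zero) (proj₂ (proj₂ wrap))

  open ReplicatedColouring W w W⊆w label label-step (proj₁ (proj₂ wrap)) wrap-reversed
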